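{- (Soundness.) If $\mathbf{MI_{\Box}} \vdash \phi$, then $\phi$ is valid on every $\Box$-frame, i.e. $\phi$ holds at every state of every $\Box$-model.
   Context: Formulas: $\phi ::= \top \mid p \mid \phi\wedge\phi \mid \phi\to\phi \mid \Box\phi$. $\mathbf{MI}$ is given by modus ponens and substitution instances of (H1) $p\to(q\to p)$, (H2) $(p\to(q\to r))\to((p\to q)\to(p\to r))$, (H3) $(p\wedge q)\to p$, (H4) $(p\wedge q)\to q$, (H5) $p\to(q\to(p\wedge q))$, (H6) $\top$. $\mathbf{MI_{\Box}}$ extends it with axioms $\Box(p\wedge q)\leftrightarrow(\Box p\wedge\Box q)$ and $\Box\top\leftrightarrow\top$ and the rule: from $p\leftrightarrow q$ infer $\Box p\leftrightarrow\Box q$ (where $\phi\leftrightarrow\psi$ abbreviates $(\phi\to\psi)\wedge(\psi\to\phi)$). An I-frame is a poset $(X,\leq)$ that is an implicative meet-semilattice with top $\top$. A $\Box$-frame is $(X,\leq,R)$ with $(X,\leq)$ an I-frame and $R\subseteq X\times X$ such that (B1) $\top R x$ iff $x=\top$, and $xR\top$ for all $x$; (B2) $xRy$ and $y\leq z$ imply $xRz$; (B3) $xRy$ and $x'Ry'$ imply $(x\wedge x')R(y\wedge y')$; (B4) if $(x\wedge x')Rz$ then there are $y,y'$ with $xRy$, $x'Ry'$, $y\wedge y'=z$. A $\Box$-model adds a valuation assigning to each letter a filter (non-empty up-closed set closed under finite meets) of $(X,\leq)$. Satisfaction: $\top$ always; $x\Vdash p$ iff $x\in V(p)$; $\wedge$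 pointwise; $x\Vdash\phi\to\psi$ iff every $y\geq x$ with $y\Vdash\phi$ has $y\Vdash\psi$; $x\Vdash\Box\phi$ iff every $y$ with $xRy$ has $y\Vdash\phi$. -}

module Defs where

open import Level using (Level; _⊔_; suc)
open import Data.Nat using (ℕ)
open import Data.Product using (Σ; ∃; _×_; _,_)
open import Relation.Binary.PropositionalEquality using (_≡_)

data Fm : Set where
  ⊤'  : Fm
  var : ℕ → Fm
  _∧'_ : Fm → Fm → Fm
  _⇒'_ : Fm → Fm → Fm
  □'  : Fm → Fm

infixr 6 _∧'_
infixr 5 _⇒'_

_⇔'_ : Fm → Fm → Fm
φ ⇔' ψ = (φ ⇒' ψ) ∧' (ψ ⇒' φ)

sub : (ℕ → Fm) → Fm → Fm
sub σ ⊤' = ⊤'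
sub σ (var n) = σ n
sub σ (φ ∧' ψ) = sub σ φ ∧' sub σ ψ
sub σ (φ ⇒' ψ) = sub σ φ ⇒' sub σ ψ
sub σ (□' φ) = □' (sub σ φ)

p q r : Fm
p = var 0
q = var 1
r = var 2

data Axiom : Fm → Set where
  H1 : Axiom (p ⇒' (q ⇒' p))
  H2 : Axiom ((p ⇒' (q ⇒' r)) ⇒' ((p ⇒' q) ⇒' (p ⇒' r)))
  H3 : Axiom ((p ∧' q) ⇒' p)
  H4 : Axiom ((p ∧' q) ⇒' q)
  H5 : Axiom (p ⇒' (q ⇒' (p ∧' q)))
  H6 : Axiom ⊤'
  K∧ : Axiom (□' (p ∧' q) ⇔' (□' p ∧' □' q))
  K⊤ : Axiom (□' ⊤' ⇔' ⊤')

data ⊢_ : Fm → Set where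
  ax   : ∀ {φ} (σ : ℕ → Fm) → Axiom φ → ⊢ sub σ φ
  mp   : ∀ {φ ψ} → ⊢ φ → ⊢ (φ ⇒' ψ) → ⊢ ψ
  cong□ : ∀ {φ ψ} → ⊢ (φ ⇔' ψ) → ⊢ (□' φ ⇔' □' ψ)

record IFrame (a ℓ : Level) : Set (suc (a ⊔ ℓ)) where
  field
    X     : Set a
    _≤_   : X → X → Set ℓ
    ≤-refl  : ∀ {x} → x ≤ x
    ≤-trans : ∀ {x y z} → x ≤ y → y ≤ z → x ≤ z
    ≤-antisym : ∀ {x y} → x ≤ y → y ≤ x → x ≡ y
    ⊤ : X
    ≤⊤ : ∀ {x} → x ≤ ⊤
    _∧_ : X → X → X
    ∧-lb₁ : ∀ {x y} → (x ∧ y) ≤ x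
    ∧-lb₂ : ∀ {x y} → (x ∧ y) ≤ y
    ∧-glb : ∀ {x y z} → z ≤ x → z ≤ y → z ≤ (x ∧ y)
    _⇒_ : X → X → X
    ⇒-adj₁ : ∀ {x y z} → z ≤ (x ⇒ y) → (z ∧ x) ≤ y
    ⇒-adj₂ : ∀ {x y z} → (z ∧ x) ≤ y → z ≤ (x ⇒ y)

record □Frame (a ℓ r : Level) : Set (suc (a ⊔ ℓ ⊔ r)) where
  field
    iframe : IFrame a ℓ
  open IFrame iframe public
  field
    R : X → X → Set r
    B1a : ∀ {x} → R ⊤ x → x ≡ ⊤
    B1b : ∀ {x} → x ≡ ⊤ → R ⊤ x
    B1c : ∀ {x} → R x ⊤
    B2 : ∀ {x y z} → R x y → y ≤ z → R x z
    B3 : ∀ {x x' y y'} → R x y → R x' y' → R (x ∧ x') (y ∧ y')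
    B4 : ∀ {x x' z} → R (x ∧ x') z →
         Σ X λ y → Σ X λ y' → R x y × R x' y' × ((y ∧ y') ≡ z)

record IsFilter {a ℓ : Level} (F : IFrame a ℓ) {s : Level} (S : IFrame.X F → Set s)
    : Set (a ⊔ ℓ ⊔ s) where
  open IFrame F
  field
    nonempty : Σ X S
    upclosed : ∀ {x y} → S x → x ≤ y → S y
    meetclosed : ∀ {x y} → S x → S y → S (x ∧ y)

record □Model (a ℓ r s : Level) : Set (suc (a ⊔ ℓ ⊔ r ⊔ s)) where
  field
    frame : □Frame a ℓ r
  open □Frame frame public
  field
    V : ℕ → X → Set s
    V-filter : ∀ n → IsFilter iframe (V n)

module _ {a ℓ r s : Level} (M : □Model a ℓ r s) where
  open □Model M
  open import Data.Unit.Polymorphic using () renaming (⊤ to Unit)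

  _⊩_ : X → Fm → Set (a ⊔ ℓ ⊔ r ⊔ s)
  x ⊩ ⊤' = Unit
  x ⊩ var n = Level.Lift (a ⊔ ℓ ⊔ r) (V n x)
  x ⊩ (φ ∧' ψ) = (x ⊩ φ) × (x ⊩ ψ)
  x ⊩ (φ ⇒' ψ) = ∀ y → x ≤ y → y ⊩ φ → y ⊩ ψ
  x ⊩ □' φ = ∀ y → R x y → y ⊩ φ

{-# OPTIONS --safe #-}
-- Satisfaction is persistent along ≤: for letters because valuations are
-- up-closed, for implications by construction, and for □ because R is
-- antitone in its first argument (a consequence of B1 and B3). Persistence
-- makes the intuitionistic axioms true everywhere and modus ponens sound;
-- the □-axioms and the congruence rule hold since □ is interpreted as a
-- universal quantifier over R-successors.
module Submission where

open import Level using (Level; _⊔_; lift)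
open import Defs
open import Data.Nat using (ℕ)
open import Data.Product using (_,_; proj₁; proj₂)
open import Relation.Binary.PropositionalEquality using (_≡_; subst₂)

module _ {a ℓ r : Level} (F : □Frame a ℓ r) where
  open □Frame F

  ∧-absorbs-≤ : ∀ {x y} → x ≤ y → (y ∧ x) ≡ x
  ∧-absorbs-≤ x≤y = ≤-antisym ∧-lb₂ (∧-glb x≤y ≤-refl)

  ∧-identityʳ : ∀ {x} → (x ∧ ⊤) ≡ x
  ∧-identityʳ = ≤-antisym ∧-lb₁ (∧-glb ≤-refl ≤⊤)

  -- Combine y R z with x R ⊤ by B3: (y ∧ x) R (z ∧ ⊤), which is x R z.
  R-antitone : ∀ {x y z} → x ≤ y → R y z → R x z
  R-antitone x≤y yRz = subst₂ R (∧-absorbs-≤ x≤y) ∧-identityʳ (B3 yRz B1c)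

module _ {a ℓ r s : Level} (M : □Model a ℓ r s) where
  open □Model M

  Valid : Fm → Set (a ⊔ ℓ ⊔ r ⊔ s)
  Valid φ = ∀ x → _⊩_ M x φ

  ⊩-persistent : ∀ φ {x y} → x ≤ y → _⊩_ M x φ → _⊩_ M y φ
  ⊩-persistent ⊤'       _   h          = h
  ⊩-persistent (var n)  x≤y (lift h)   = lift (IsFilter.upclosed (V-filter n) h x≤y)
  ⊩-persistent (φ ∧' ψ) x≤y (h₁ , h₂)  = ⊩-persistent φ x≤y h₁ , ⊩-persistent ψ x≤y h₂
  ⊩-persistent (φ ⇒' ψ) x≤y h z y≤z hφ = h z (≤-trans x≤y y≤z) hφ
  ⊩-persistent (□' φ)   x≤y h z yRz    = h z (R-antitone frame x≤y yRz)

  ⊩-⇒-elim : ∀ {φ ψ x} → _⊩_ M x (φ ⇒' ψ) → _⊩_ M x φ → _⊩_ M x ψ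
  ⊩-⇒-elim {x = x} h = h x ≤-refl

  Valid-mp : ∀ {φ ψ} → Valid φ → Valid (φ ⇒' ψ) → Valid ψ
  Valid-mp ⊨φ ⊨φ⇒ψ x = ⊩-⇒-elim (⊨φ⇒ψ x) (⊨φ x)

  Valid-□-mono : ∀ {φ ψ} → Valid (φ ⇒' ψ) → Valid (□' φ ⇒' □' ψ)
  Valid-□-mono ⊨φ⇒ψ _ y _ h z yRz = ⊩-⇒-elim (⊨φ⇒ψ z) (h z yRz)

  Valid-□-cong : ∀ {φ ψ} → Valid (φ ⇔' ψ) → Valid (□' φ ⇔' □' ψ)
  Valid-□-cong ⊨φ⇔ψ x = Valid-□-mono (λ y → proj₁ (⊨φ⇔ψ y)) x
                      , Valid-□-mono (λ y → proj₂ (⊨φ⇔ψ y)) x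

  Valid-axiom : ∀ {φ} (σ : ℕ → Fm) → Axiom φ → Valid (sub σ φ)
  Valid-axiom σ H1 _ y _ hp z y≤z _ = ⊩-persistent (σ 0) y≤z hp
  Valid-axiom σ H2 _ y _ h z y≤z h' w z≤w hp =
    h w (≤-trans y≤z z≤w) hp w ≤-refl (h' w z≤w hp)
  Valid-axiom σ H3 _ _ _ (hp , _) = hp
  Valid-axiom σ H4 _ _ _ (_ , hq) = hq
  Valid-axiom σ H5 _ y _ hp z y≤z hq = ⊩-persistent (σ 0) y≤z hp , hq
  Valid-axiom σ H6 _ = _
  Valid-axiom σ K∧ _ = (λ _ _ h → (λ z yRz → proj₁ (h z yRz)) , (λ z yRz → proj₂ (h z yRz)))
                     , (λ _ _ h z yRz → proj₁ h z yRz , proj₂ h z yRz)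
  Valid-axiom σ K⊤ _ = (λ _ _ _ → _) , (λ _ _ _ _ _ → _)

  soundness : ∀ {φ} → ⊢ φ → Valid φ
  soundness (ax σ A)  = Valid-axiom σ A
  soundness (mp d e)  = Valid-mp (soundness d) (soundness e)
  soundness (cong□ d) = Valid-□-cong (soundness d)

proposition4p4 : ∀ {φ : Fm} → ⊢ φ →
    ∀ {a ℓ r s : Level} (M : □Model a ℓ r s) (x : □Model.X M) → _⊩_ M x φ
proposition4p4 d M = soundness M d
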